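{- Let $d$ be a positive integer, let $H=(V,E)$ be a hypergraph, let $e_1,e_2\in E$, and let $H'=(V,E\cup\{e\})$ where $e=e_1\cap e_2$. If $H'$ has a $d$-semi-ladder, then $H$ has a $d$-semi-ladder.
   Context: A hypergraph is a pair $H=(V,E)$ with $V$ finite and $E\subseteq 2^V$. A $d$-semi-ladder in $H$ is a pair $(W,F)$ with $W=\{w_0,\ldots,w_d\}\subseteq V$, $F=\{f_0,\ldots,f_d\}\subseteq E$, such that $w_i\notin f_i$ for each $i\in[0;d]$ and $w_i\in f_j$ whenever $0\le i<j\le d$. -}

module Defs where

open import Data.Nat using (ℕ; suc)
open import Data.Fin using (Fin; _<_)
open import Data.Fin.Subset using (Subset; _∈_; _∉_; _∩_)
open import Data.List using (List; _∷_)
import Data.List.Membership.Propositional as L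
open import Data.Product using (Σ; _×_)
open import Function.Definitions using (Injective)
open import Relation.Binary.PropositionalEquality using (_≡_)

-- A hypergraph on vertex set V = Fin n, with a finite edge set given
-- as a list of subsets (multiplicities / order are irrelevant).
record Hypergraph : Set where
  constructor hyp
  field
    n     : ℕ
    edges : List (Subset n)

open Hypergraph public

record SemiLadder (H : Hypergraph) (d : ℕ) : Set where
  field
    w      : Fin (suc d) → Fin (n H)
    f      : Fin (suc d) → Subset (n H)
    w-inj  : Injective _≡_ _≡_ w
    f-inj  : Injective _≡_ _≡_ f
    f∈E    : ∀ i → f i L.∈ edges H
    w∉f    : ∀ i → w i ∉ f i
    w∈f    : ∀ i j → i < j → w i ∈ f j

addIntersection : (H : Hypergraph) → Subset (n H) → Subset (n H) → Hypergraph
addIntersection (hyp n E) e₁ e₂ = hyp n ((e₁ ∩ e₂) ∷ E)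

module Submission where

open import Defs
open import Data.Nat using (ℕ; _≥_)
open import Data.Fin using (Fin; _<_)
open import Data.Fin.Properties using (<-cmp)
open import Data.Fin.Subset using (Subset; _∈_; _∉_; _⊆_; _∩_)
open import Data.Fin.Subset.Properties using (_∈?_; x∈p∩q⁺; p∩q⊆p; p∩q⊆q)
open import Data.List using (List; _∷_)
import Data.List.Membership.Propositional as L
open import Data.List.Relation.Unary.Any using (here; there)
open import Data.Product using (_,_)
open import Data.Empty using (⊥-elim)
open import Function.Definitions using (Injective)
open import Relation.Binary using (tri<; tri≈; tri>)
open import Relation.Binary.PropositionalEquality using (_≡_; refl; subst; sym)
open import Relation.Nullary using (yes; no)

-- Proof idea: an edge f with w ∉ f of E ∪ {e₁ ∩ e₂} lies inside an edge of E
-- still missing w (f itself, or whichever of e₁, e₂ misses w). Replacing every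
-- fᵢ by such a superedge keeps wᵢ ∉ fᵢ and wᵢ ∈ fⱼ for i < j, and these two
-- conditions alone force the new edges to be pairwise distinct.

record SuperedgeAvoiding {m : ℕ} (E : List (Subset m)) (x : Fin m) (f : Subset m) : Set where
  field
    edge   : Subset m
    edge∈E : edge L.∈ E
    x∉edge : x ∉ edge
    f⊆edge : f ⊆ edge

open SuperedgeAvoiding

superedgeAvoiding : ∀ {m} {E : List (Subset m)} {e₁ e₂ : Subset m} →
  e₁ L.∈ E → e₂ L.∈ E → ∀ {x f} → x ∉ f → f L.∈ (e₁ ∩ e₂) ∷ E →
  SuperedgeAvoiding E x f
superedgeAvoiding _ _ x∉f (there f∈E) = record
  { edge = _ ; edge∈E = f∈E ; x∉edge = x∉f ; f⊆edge = λ y∈f → y∈f }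
superedgeAvoiding {e₁ = e₁} {e₂} e₁∈E e₂∈E {x} x∉e₁∩e₂ (here refl) with x ∈? e₁
... | yes x∈e₁ = record
  { edge = e₂ ; edge∈E = e₂∈E
  ; x∉edge = λ x∈e₂ → x∉e₁∩e₂ (x∈p∩q⁺ (x∈e₁ , x∈e₂))
  ; f⊆edge = p∩q⊆q e₁ e₂ }
... | no x∉e₁ = record
  { edge = e₁ ; edge∈E = e₁∈E ; x∉edge = x∉e₁ ; f⊆edge = p∩q⊆p e₁ e₂ }

semiLadder-edges-injective : ∀ {k m} (w : Fin k → Fin m) (f : Fin k → Subset m) →
  (∀ i → w i ∉ f i) → (∀ i j → i < j → w i ∈ f j) → Injective _≡_ _≡_ f
semiLadder-edges-injective w f w∉f w∈f {i} {j} fi≡fj with <-cmp i j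
... | tri< i<j _ _ = ⊥-elim (w∉f i (subst (w i ∈_) (sym fi≡fj) (w∈f i j i<j)))
... | tri≈ _ i≡j _ = i≡j
... | tri> _ _ j<i = ⊥-elim (w∉f j (subst (w j ∈_) fi≡fj (w∈f j i j<i)))

lemma1 : (d : ℕ) → d ≥ 1 → (H : Hypergraph) → (e₁ e₂ : Subset (n H)) →
    e₁ L.∈ edges H → e₂ L.∈ edges H →
    SemiLadder (addIntersection H e₁ e₂) d → SemiLadder H d
lemma1 d _ (hyp m E) e₁ e₂ e₁∈E e₂∈E L = record
  { w     = w
  ; f     = g
  ; w-inj = w-inj
  ; f-inj = semiLadder-edges-injective w g w∉g w∈g
  ; f∈E   = λ i → edge∈E (S i)
  ; w∉f   = w∉g
  ; w∈f   = w∈g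
  }
  where
  open SemiLadder L
  S : ∀ i → SuperedgeAvoiding E (w i) (f i)
  S i = superedgeAvoiding e₁∈E e₂∈E (w∉f i) (f∈E i)
  g : Fin _ → Subset m
  g i = edge (S i)
  w∉g : ∀ i → w i ∉ g i
  w∉g i = x∉edge (S i)
  w∈g : ∀ i j → i < j → w i ∈ g j
  w∈g i j i<j = f⊆edge (S j) (w∈f i j i<j)
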